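{- Fix $D\in\mathbb N$. Let $\mathcal S$ be a Büchi automaton over $\Sigma$, let $a\in\mathit{Ag}$, and let $e\in\mathit{AP}\setminus\mathit{AP}_a$. Then $\mathcal S$ is $D$-P-diagnosable (wrt. $a$ and $e$) if and only if $\mathcal S$ is $D$-N-diagnosable (wrt. $a$ and $e$).
   Context: Fix a finite set $\mathit{AP}$ of atomic propositions, $\Sigma=2^{\mathit{AP}}$, and a finite set $\mathit{Ag}$ of agents with observable propositions $\mathit{AP}_a\subseteq\mathit{AP}$ for $a\in\mathit{Ag}$. $\mathit{obs}_a(\sigma)=\sigma\cap\mathit{AP}_a$, extended letterwise to words; $w_{\le k}$ is the length-$k$ prefix of $w$. A Büchi automaton $\mathcal S$ over $\Sigma$ accepts $L(\mathcal S)\subseteq\Sigma^\omega$ (infinite words with a run from the initial state visiting accepting states infinitely often). Epistemic LTL semantics, for $w=\sigma_1\sigma_2\cdots\in L(\mathcal S)$ and position $k\ge1$: $\mathcal S,w,k\models p$ iff $p\in\sigma_k$; Boolean cases as usual; $\varphi\,\mathsf U^+\psi$ holds at $k$ iff there is $j>k$ with $\psi$ at $j$ and $\varphi$ at all $k<i<j$; $\varphi\,\mathsf S^+\psi$ holds at $k$ iff there is $1\le j<k$ with $\psi$ at $j$ and $\varphi$ at all $j<i<k$; $\mathsf K_a\varphi$ holds at $k$ iff $\mathcal S,w',k\models\varphi$ for all $w'\in L(\mathcal S)$ with $\mathit{obs}_a(w_{\le k})=\mathit{obs}_a(w'_{\le k})$. $\mathcal S\models\varphi$ means $\mathcal S,w,1\models\varphi$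 for all $w\in L(\mathcal S)$. Derived: $\top,\bot$ as usual; $\mathsf X\varphi=\bot\,\mathsf U^+\varphi$ (holds at $k$ iff $\varphi$ holds at $k+1$), $\mathsf Y\varphi=\bot\,\mathsf S^+\varphi$ (holds at $k$ iff $k\ge2$ and $\varphi$ holds at $k-1$); $\mathsf X^0\varphi=\mathsf Y^0\varphi=\varphi$, $\mathsf X^{i+1}\varphi=\mathsf X\mathsf X^i\varphi$, $\mathsf Y^{i+1}\varphi=\mathsf Y\mathsf Y^i\varphi$; $\mathsf F\varphi$ holds at $k$ iff $\varphi$ holds at some $j\ge k$, $\mathsf G=\neg\mathsf F\neg$; $\mathsf P\varphi$ holds at $k$ iff $\varphi$ holds at some $1\le j\le k$, $\mathsf H=\neg\mathsf P\neg$. $\mathcal S$ is $D$-P-diagnosable wrt. $a$ and $e$ if $\mathcal S\models\mathsf G(e\to\mathsf X^D\mathsf K_a\mathsf Pe)$, and $D$-N-diagnosable if $\mathcal S\models\mathsf X^D\mathsf G(\mathsf H\neg e\to\mathsf K_a\mathsf Y^D\mathsf H\neg e)$. -}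

module Defs where

open import Data.Nat using (ℕ; zero; suc; _≤_; _<_)
open import Data.Fin using (Fin)
open import Data.Fin.Subset using (Subset; _∈_; _∩_)
open import Data.Bool using (Bool; true)
open import Data.Product using (Σ; _×_; ∃)
open import Data.Unit using (⊤)
open import Data.Empty using (⊥)
open import Data.Sum using (_⊎_)
open import Relation.Nullary using (¬_)
open import Relation.Binary.PropositionalEquality using (_≡_)

-- Atomic propositions: AP = Fin n.  Letters: Σ = 2^AP = Subset n.
-- Agents: Ag = Fin m.  Observable propositions AP_a given by  obsP : Fin m → Subset n.

Letter : ℕ → Set
Letter n = Subset n

-- Infinite words, 0-indexed: w i is the (i+1)-th letter σ_{i+1}.
Word : ℕ → Set
Word n = ℕ → Letter n

record Buchi (n : ℕ) : Set where
  field
    q       : ℕ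
    init    : Fin q
    δ       : Fin q → Letter n → Fin q → Bool
    accept  : Subset q

open Buchi public

AcceptingRun : ∀ {n} (S : Buchi n) → Word n → (ℕ → Fin (q S)) → Set
AcceptingRun S w ρ =
  (ρ 0 ≡ init S)
  × (∀ i → δ S (ρ i) (w i) (ρ (suc i)) ≡ true)
  × (∀ i → ∃ λ j → i ≤ j × ρ j ∈ accept S)

InLang : ∀ {n} (S : Buchi n) → Word n → Set
InLang S w = Σ (ℕ → Fin (q S)) λ ρ → AcceptingRun S w ρ

data Form (n m : ℕ) : Set where
  atom : Fin n → Form n m
  tt   : Form n m
  ¬ᶠ_  : Form n m → Form n m
  _∧ᶠ_ : Form n m → Form n m → Form n m
  _U⁺_ : Form n m → Form n m → Form n m
  _S⁺_ : Form n m → Form n m → Form n m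
  K    : Fin m → Form n m → Form n m

module _ {n m : ℕ} where
  ff : Form n m
  ff = ¬ᶠ tt

  _∨ᶠ_ : Form n m → Form n m → Form n m
  φ ∨ᶠ ψ = ¬ᶠ ((¬ᶠ φ) ∧ᶠ (¬ᶠ ψ))

  _⇒ᶠ_ : Form n m → Form n m → Form n m
  φ ⇒ᶠ ψ = (¬ᶠ φ) ∨ᶠ ψ

  X : Form n m → Form n m
  X φ = ff U⁺ φ

  Y : Form n m → Form n m
  Y φ = ff S⁺ φ

  Xⁱ : ℕ → Form n m → Form n m
  Xⁱ zero φ = φ
  Xⁱ (suc i) φ = X (Xⁱ i φ)

  Yⁱ : ℕ → Form n m → Form n m
  Yⁱ zero φ = φ
  Yⁱ (suc i) φ = Y (Yⁱ i φ)

  F : Form n m → Form n m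
  F φ = φ ∨ᶠ (tt U⁺ φ)

  G : Form n m → Form n m
  G φ = ¬ᶠ (F (¬ᶠ φ))

  P : Form n m → Form n m
  P φ = φ ∨ᶠ (tt S⁺ φ)

  H : Form n m → Form n m
  H φ = ¬ᶠ (P (¬ᶠ φ))

-- obs_a(w_{≤k}) = obs_a(w'_{≤k}) for 0-indexed position k, i.e. the
-- letters at indices 0..k agree after intersecting with AP_a.
SameObs : ∀ {n m} (obsP : Fin m → Subset n) (a : Fin m) (k : ℕ) (w w' : Word n) → Set
SameObs obsP a k w w' = ∀ i → i ≤ k → (w i ∩ obsP a) ≡ (w' i ∩ obsP a)

-- Satisfaction S, w, k ⊨ φ   (k is 0-indexed: paper position k+1).
Sat : ∀ {n m} (obsP : Fin m → Subset n) (S : Buchi n) → Word n → ℕ → Form n m → Set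
Sat obsP S w k (atom p) = p ∈ w k
Sat obsP S w k tt = ⊤
Sat obsP S w k (¬ᶠ φ) = ¬ Sat obsP S w k φ
Sat obsP S w k (φ ∧ᶠ ψ) = Sat obsP S w k φ × Sat obsP S w k ψ
Sat obsP S w k (φ U⁺ ψ) =
  ∃ λ j → k < j × Sat obsP S w j ψ × (∀ i → k < i → i < j → Sat obsP S w i φ)
Sat obsP S w k (φ S⁺ ψ) =
  ∃ λ j → j < k × Sat obsP S w j ψ × (∀ i → j < i → i < k → Sat obsP S w i φ)
Sat obsP S w k (K a φ) =
  ∀ w' → InLang S w' → SameObs obsP a k w w' → Sat obsP S w' k φ

Models : ∀ {n m} (obsP : Fin m → Subset n) (S : Buchi n) → Form n m → Set
Models obsP S φ = ∀ w → InLang S w → Sat obsP S w 0 φ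

PDiagnosable : ∀ {n m} (obsP : Fin m → Subset n) (D : ℕ) (S : Buchi n) (a : Fin m) (e : Fin n) → Set
PDiagnosable obsP D S a e = Models obsP S (G (atom e ⇒ᶠ Xⁱ D (K a (P (atom e)))))

NDiagnosable : ∀ {n m} (obsP : Fin m → Subset n) (D : ℕ) (S : Buchi n) (a : Fin m) (e : Fin n) → Set
NDiagnosable obsP D S a e =
  Models obsP S (Xⁱ D (G (H (¬ᶠ atom e) ⇒ᶠ K a (Yⁱ D (H (¬ᶠ atom e))))))

{-# OPTIONS --safe #-}
-- Unfolding the temporal operators, D-P-diagnosability says: if e occurs in w
-- at k, every w' ∈ L(S) with the same a-observations up to k + D contains an
-- e up to k + D.  D-N-diagnosability says: if w is e-free up to k + D, every
-- w' ∈ L(S) with the same a-observations up to k + D is e-free up to k.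
-- With the roles of w and w' exchanged each is the contrapositive of the
-- other, because equal observations and e-freedom pass to shorter prefixes.  Constructively, G, H, P and ⇒ unfold
-- only up to double negation, which is harmless because both conditions have
-- negative conclusions.
module Submission where

open import Defs
open import Data.Nat using (ℕ; zero; suc; _+_; _≤_; _<_; z≤n)
open import Data.Nat.Properties
  using ( ≤-refl; ≤-trans; <⇒≤; <⇒≱; m<1+n⇒m≤n; m≤n⇒m<n∨m≡n; m≤m+n; m≤n⇒∃[o]m+o≡n
        ; +-suc; +-identityʳ; +-monoʳ-≤)
open import Data.Fin using (Fin)
open import Data.Fin.Subset using (Subset; _∈_; _∉_)
open import Data.Product using (_,_; ∃)
open import Data.Sum using (inj₁; inj₂; [_,_])
open import Data.Unit using (tt)
open import Data.Empty using (⊥-elim)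
open import Relation.Nullary using (¬_)
open import Relation.Binary.PropositionalEquality using (_≡_; refl; sym; subst)
open import Function.Bundles using (_⇔_; mk⇔; Equivalence)
import Function.Properties.Equivalence as ⇔

open Equivalence using (to; from)

module _ {n m : ℕ} (obsP : Fin m → Subset n) (S : Buchi n) (w : Word n) where

  private
    infix 4 _⊨_
    _⊨_ : ℕ → Form n m → Set
    k ⊨ φ = Sat obsP S w k φ

  X-sat : ∀ {k φ} → k ⊨ X φ ⇔ suc k ⊨ φ
  X-sat {k} {φ} =
    mk⇔ next λ s → suc k , ≤-refl , s , λ i k<i i<1+k _ → <⇒≱ k<i (m<1+n⇒m≤n i<1+k)
    where
    next : k ⊨ X φ → suc k ⊨ φ
    next (j , k<j , s , gap) with m≤n⇒m<n∨m≡n k<j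
    ... | inj₁ 1+k<j = ⊥-elim (gap (suc k) ≤-refl 1+k<j tt)
    ... | inj₂ refl = s

  Y-sat : ∀ {k φ} → suc k ⊨ Y φ ⇔ k ⊨ φ
  Y-sat {k} {φ} =
    mk⇔ previous λ s → k , ≤-refl , s , λ i k<i i<1+k _ → <⇒≱ k<i (m<1+n⇒m≤n i<1+k)
    where
    previous : suc k ⊨ Y φ → k ⊨ φ
    previous (j , j<1+k , s , gap) with m≤n⇒m<n∨m≡n (m<1+n⇒m≤n j<1+k)
    ... | inj₁ j<k = ⊥-elim (gap k j<k ≤-refl tt)
    ... | inj₂ refl = s

  Xⁱ-sat : ∀ D {k φ} → k ⊨ Xⁱ D φ ⇔ D + k ⊨ φ
  Xⁱ-sat zero = ⇔.refl
  Xⁱ-sat (suc D) {k} {φ} =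
    subst (λ i → k ⊨ Xⁱ (suc D) φ ⇔ i ⊨ φ) (+-suc D k) (⇔.trans X-sat (Xⁱ-sat D))

  Xⁱ-sat₀ : ∀ D {φ} → 0 ⊨ Xⁱ D φ ⇔ D ⊨ φ
  Xⁱ-sat₀ D {φ} = subst (λ i → 0 ⊨ Xⁱ D φ ⇔ i ⊨ φ) (+-identityʳ D) (Xⁱ-sat D)

  Yⁱ-sat : ∀ D {k φ} → D + k ⊨ Yⁱ D φ ⇔ k ⊨ φ
  Yⁱ-sat zero = ⇔.refl
  Yⁱ-sat (suc D) = ⇔.trans Y-sat (Yⁱ-sat D)

  F-sat : ∀ {k φ} → k ⊨ F φ ⇔ (¬ (∀ j → k ≤ j → j ⊨ ¬ᶠ φ))
  F-sat {k} {φ} =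
    mk⇔ (λ f never → f (never k ≤-refl , λ (j , k<j , s , _) → never j (<⇒≤ k<j) s)) sometime
    where
    sometime : ¬ (∀ j → k ≤ j → j ⊨ ¬ᶠ φ) → k ⊨ F φ
    sometime ¬never (¬now , ¬later) = ¬never λ j k≤j s →
      [ (λ k<j → ¬later (j , k<j , s , λ _ _ _ → tt)) , (λ { refl → ¬now s }) ]
        (m≤n⇒m<n∨m≡n k≤j)

  P-sat : ∀ {k φ} → k ⊨ P φ ⇔ (¬ (∀ j → j ≤ k → j ⊨ ¬ᶠ φ))
  P-sat {k} {φ} =
    mk⇔ (λ p never → p (never k ≤-refl , λ (j , j<k , s , _) → never j (<⇒≤ j<k) s)) sometime
    where
    sometime : ¬ (∀ j → j ≤ k → j ⊨ ¬ᶠ φ) → k ⊨ P φ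
    sometime ¬never (¬now , ¬before) = ¬never λ j j≤k s →
      [ (λ j<k → ¬before (j , j<k , s , λ _ _ _ → tt)) , (λ { refl → ¬now s }) ]
        (m≤n⇒m<n∨m≡n j≤k)

  -- G (¬ᶠ φ) and H (¬ᶠ φ) are ¬ᶠ F (¬ᶠ ¬ᶠ φ) and ¬ᶠ P (¬ᶠ ¬ᶠ φ); the triple negations collapse.
  G¬-sat : ∀ {k φ} → k ⊨ G (¬ᶠ φ) ⇔ (∀ j → k ≤ j → j ⊨ ¬ᶠ φ)
  G¬-sat {φ = φ} = mk⇔
    (λ g j k≤j s → g (from (F-sat {φ = ¬ᶠ ¬ᶠ φ}) λ never → never j k≤j λ ¬s → ¬s s))
    (λ never f → to (F-sat {φ = ¬ᶠ ¬ᶠ φ}) f λ j k≤j ¬¬s → ¬¬s (never j k≤j))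

  G⇒ᶠ-sat : ∀ {k φ ψ} → k ⊨ G (φ ⇒ᶠ ψ) ⇔ (∀ j → k ≤ j → j ⊨ φ ⇒ᶠ ψ)
  G⇒ᶠ-sat {φ = φ} {ψ} = G¬-sat {φ = (¬ᶠ ¬ᶠ φ) ∧ᶠ (¬ᶠ ψ)}

  H¬-sat : ∀ {k φ} → k ⊨ H (¬ᶠ φ) ⇔ (∀ j → j ≤ k → j ⊨ ¬ᶠ φ)
  H¬-sat {φ = φ} = mk⇔
    (λ h j j≤k s → h (from (P-sat {φ = ¬ᶠ ¬ᶠ φ}) λ never → never j j≤k λ ¬s → ¬s s))
    (λ never p → to (P-sat {φ = ¬ᶠ ¬ᶠ φ}) p λ j j≤k ¬¬s → ¬¬s (never j j≤k))

  ⇒ᶠ-intro : ∀ {k φ ψ} → (k ⊨ φ → k ⊨ ψ) → k ⊨ φ ⇒ᶠ ψ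
  ⇒ᶠ-intro f (¬¬s , ¬t) = ¬¬s λ s → ¬t (f s)

  ⇒ᶠ-elim : ∀ {k φ ψ} → k ⊨ φ ⇒ᶠ ψ → k ⊨ φ → ¬ ¬ (k ⊨ ψ)
  ⇒ᶠ-elim imp s ¬t = imp ((λ ¬s → ¬s s) , ¬t)

module _ {n m : ℕ} (obsP : Fin m → Subset n) (a : Fin m) where

  SameObs-sym : ∀ {k w w'} → SameObs obsP a k w w' → SameObs obsP a k w' w
  SameObs-sym same i i≤k = sym (same i i≤k)

  SameObs-antimono : ∀ {j k w w'} → j ≤ k → SameObs obsP a k w w' → SameObs obsP a j w w'
  SameObs-antimono j≤k same i i≤j = same i (≤-trans i≤j j≤k)

module _ {n m : ℕ} (obsP : Fin m → Subset n) (D : ℕ) (S : Buchi n) (a : Fin m) (e : Fin n) where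

  EventFree : Word n → ℕ → Set
  EventFree w k = ∀ j → j ≤ k → e ∉ w j

  EventFree-antimono : ∀ {w j k} → j ≤ k → EventFree w k → EventFree w j
  EventFree-antimono j≤k free i i≤j = free i (≤-trans i≤j j≤k)

  TracePDiagnosable : Set
  TracePDiagnosable = ∀ {w w'} → InLang S w → InLang S w' →
    ∀ k → e ∈ w k → SameObs obsP a (D + k) w w' → ¬ EventFree w' (D + k)

  TraceNDiagnosable : Set
  TraceNDiagnosable = ∀ {w w'} → InLang S w → InLang S w' →
    ∀ k → EventFree w (D + k) → SameObs obsP a (D + k) w w' → EventFree w' k

  TracePDiagnosable⇔TraceNDiagnosable : TracePDiagnosable ⇔ TraceNDiagnosable
  TracePDiagnosable⇔TraceNDiagnosable = mk⇔ P⇒N N⇒P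
    where
    P⇒N : TracePDiagnosable → TraceNDiagnosable
    P⇒N pd w∈L w'∈L k free same j j≤k ej = pd w'∈L w∈L j ej
      (SameObs-sym obsP a (SameObs-antimono obsP a D+j≤D+k same))
      (EventFree-antimono D+j≤D+k free)
      where D+j≤D+k = +-monoʳ-≤ D j≤k

    N⇒P : TraceNDiagnosable → TracePDiagnosable
    N⇒P nd w∈L w'∈L k ek same free' = nd w'∈L w∈L k free' (SameObs-sym obsP a same) k ≤-refl ek

  PDiagnosable⇔TracePDiagnosable : PDiagnosable obsP D S a e ⇔ TracePDiagnosable
  PDiagnosable⇔TracePDiagnosable = mk⇔ sound complete
    where
    sound : PDiagnosable obsP D S a e → TracePDiagnosable
    sound pd {w} {w'} w∈L w'∈L k ek same free' =
      ⇒ᶠ-elim obsP S w (to (G⇒ᶠ-sat obsP S w) (pd w w∈L) k z≤n) ek λ detected →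
        to (P-sat obsP S w') (to (Xⁱ-sat obsP S w D) detected w' w'∈L same) free'

    complete : TracePDiagnosable → PDiagnosable obsP D S a e
    complete tpd w w∈L =
      from (G⇒ᶠ-sat obsP S w) λ k _ → ⇒ᶠ-intro obsP S w λ ek →
        from (Xⁱ-sat obsP S w D) λ w' w'∈L same →
          from (P-sat obsP S w') (tpd w∈L w'∈L k ek same)

  NDiagnosable⇔TraceNDiagnosable : NDiagnosable obsP D S a e ⇔ TraceNDiagnosable
  NDiagnosable⇔TraceNDiagnosable = mk⇔ sound complete
    where
    absent certified : Form n m
    absent = H (¬ᶠ atom e)
    certified = K a (Yⁱ D absent)

    sound : NDiagnosable obsP D S a e → TraceNDiagnosable
    sound nd {w} {w'} w∈L w'∈L k free same j j≤k ej =
      ⇒ᶠ-elim obsP S w {φ = absent} {ψ = certified} alarm (from (H¬-sat obsP S w) free) λ knows →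
        to (H¬-sat obsP S w') (to (Yⁱ-sat obsP S w' D) (knows w' w'∈L same)) j j≤k ej
      where
      alarm : Sat obsP S w (D + k) (absent ⇒ᶠ certified)
      alarm = to (G⇒ᶠ-sat obsP S w {φ = absent} {ψ = certified})
        (to (Xⁱ-sat₀ obsP S w D) (nd w w∈L)) (D + k) (m≤m+n D k)

    complete : TraceNDiagnosable → NDiagnosable obsP D S a e
    complete tnd w w∈L =
      from (Xⁱ-sat₀ obsP S w D) (from (G⇒ᶠ-sat obsP S w {φ = absent} {ψ = certified})
        λ j D≤j → certify (m≤n⇒∃[o]m+o≡n D≤j))
      where
      certify : ∀ {j} → ∃ (λ k → D + k ≡ j) → Sat obsP S w j (absent ⇒ᶠ certified)
      certify (k , refl) = ⇒ᶠ-intro obsP S w {φ = absent} {ψ = certified} λ free w' w'∈L same →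
        from (Yⁱ-sat obsP S w' D) (from (H¬-sat obsP S w')
          (tnd w∈L w'∈L k (to (H¬-sat obsP S w) free) same))

proposition3p3 : {n m : ℕ} (obsP : Fin m → Subset n) (D : ℕ) (S : Buchi n)
    (a : Fin m) (e : Fin n) → e ∉ obsP a →
    PDiagnosable obsP D S a e ⇔ NDiagnosable obsP D S a e
proposition3p3 obsP D S a e _ =
  ⇔.trans (PDiagnosable⇔TracePDiagnosable obsP D S a e)
    (⇔.trans (TracePDiagnosable⇔TraceNDiagnosable obsP D S a e)
      (⇔.sym (NDiagnosable⇔TraceNDiagnosable obsP D S a e)))
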